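{- Let $l_1\leq l_2\leq l$ be positive integers and let $S$ be the set of all pairs $(a,b)\in\mathbb{Z}^2$ such that: (1) if $|a|\geq|b|$ then $|b|\leq\frac{2l-1}{l_2}$ and $|a|\leq\frac{2l-1+|b|l_2}{l_1}$; and (2) if $|b|\geq|a|$ then $|a|\leq\frac{2l-1}{l_1}$ and $|b|\leq\frac{2l-1+|a|l_1}{l_2}$. Then $S$ is finite and $|S|\leq\frac{64\,l^2}{l_1l_2}$.
   Context: In the paper $l_1,l_2,l$ are $\Delta_P(x)\leq\Delta_P(y)\leq\Delta_P(z)$ for a lattice polytope $P\subset\mathbb{R}^3$, where $\Delta_P(f)=\max_P f-\min_P f$; the statement only depends on the numbers $l_1\leq l_2\leq l$. -}

module Defs where

open import Data.Nat using (ℕ; _+_; _*_; _∸_; _≤_)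
open import Data.Integer using (ℤ; ∣_∣)
open import Data.Product using (_×_; _,_)

-- 2l - 1 (natural subtraction; l ≥ 1 in the theorem so this is exact)
twoLm1 : ℕ → ℕ
twoLm1 l = 2 * l ∸ 1

-- Membership in S, with divisions by the positive integers l₁, l₂
-- cleared:  x ≤ N / d  ⇔  x * d ≤ N   (d > 0).
-- (1) |a| ≥ |b| → |b| ≤ (2l-1)/l₂  and  |a| ≤ (2l-1+|b| l₂)/l₁
-- (2) |b| ≥ |a| → |a| ≤ (2l-1)/l₁  and  |b| ≤ (2l-1+|a| l₁)/l₂
InS : ℕ → ℕ → ℕ → ℤ × ℤ → Set
InS l₁ l₂ l (a , b) =
  (∣ b ∣ ≤ ∣ a ∣ →
     (∣ b ∣ * l₂ ≤ twoLm1 l) × (∣ a ∣ * l₁ ≤ twoLm1 l + ∣ b ∣ * l₂))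
  × (∣ a ∣ ≤ ∣ b ∣ →
     (∣ a ∣ * l₁ ≤ twoLm1 l) × (∣ b ∣ * l₂ ≤ twoLm1 l + ∣ a ∣ * l₁))

-- Write L = 2l - 1, α = ⌊L/l₁⌋, β = ⌊L/l₂⌋.  We slice S by rows b = const
-- and see that a point (a , b) of S lies in an explicit finite list of
-- candidates for a, depending only on k = |b|:
--   * inner rows (k l₂ ≤ L):  |a| l₁ ≤ L + k l₂, a "ball" |a| ≤ ⌊(L + k l₂)/l₁⌋;
--   * outer rows (k l₂ > L):  k l₂ - L ≤ |a| l₁ ≤ L, an "annulus" q < |a| ≤ α.
-- Every point of S has |b| l₂ ≤ 2L, so only the rows |b| ≤ 2β + 1 occur.
-- Filtering the candidate list by membership in S and removing duplicates
-- gives the list witnessing finiteness; it remains to count candidates.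
-- An inner row k and the outer row β + 1 + k together have at most
-- (4L + 3l₁)/l₁ candidates: the growth of the first is exactly compensated
-- by the shrinking of the second.  Pairing the rows this way (the row β + 1
-- of negative b is left alone) gives
--   #candidates · l₁ l₂ ≤ (2L + l₂)(4L + 3l₁) + 2(L + l₁) l₂ ≤ 61 l².
module Submission where

open import Defs
open import Data.Nat using (ℕ; zero; suc; _+_; _*_; _∸_; _≤_; _<_; _≤?_; z≤n; s≤s; NonZero)
open import Data.Nat.Properties
open import Data.Nat.DivMod using (_/_; _%_; m/n*n≤m; m*n/n≡m; /-monoˡ-≤; m≡m%n+[m/n]*n; m%n<n; m<n*o⇒m/o<n)
open import Data.Nat.Tactic.RingSolver using (solve-∀)
open import Data.Integer using (ℤ; ∣_∣; -[1+_]) renaming (+_ to pos)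
import Data.Integer as ℤ
open import Data.Product using (Σ; _×_; _,_; proj₁; proj₂)
open import Data.Product.Properties using (≡-dec)
open import Data.Sum using (inj₁; inj₂)
open import Data.List using (List; length; map; concatMap; downFrom; filter; deduplicate; _++_)
open import Data.List.Properties using (length-++; length-map; length-downFrom; length-filter; length-deduplicate; concatMap-++)
import Data.List.Relation.Unary.Any as Any
open import Data.List.Relation.Unary.Unique.Propositional using (Unique)
import Data.List.Relation.Unary.Unique.DecPropositional.Properties as UniqueDec
open import Data.List.Membership.Propositional using (_∈_)
open import Data.List.Membership.Propositional.Properties
  using (∈-++⁺ˡ; ∈-++⁺ʳ; ∈-map⁺; ∈-downFrom⁺; ∈-concatMap⁺; ∈-filter⁺; ∈-filter⁻; ∈-deduplicate⁺; ∈-deduplicate⁻)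
open import Function.Bundles using (_⇔_; mk⇔)
open import Relation.Binary.Definitions using (DecidableEquality)
open import Relation.Nullary using (Dec; yes; no; contradiction)
open import Relation.Nullary.Decidable using (_×-dec_; _→-dec_)
open import Relation.Binary.PropositionalEquality using (_≡_; refl; sym; trans; cong; cong₂; subst; module ≡-Reasoning)

≤-div : ∀ m o d .{{_ : NonZero d}} → m * d ≤ o → m ≤ o / d
≤-div m o d md≤o = subst (_≤ o / d) (m*n/n≡m m d) (/-monoˡ-≤ d md≤o)

<-div-suc : ∀ m d .{{_ : NonZero d}} → m < suc (m / d) * d
<-div-suc m d = begin-strict
    m                 ≡⟨ m≡m%n+[m/n]*n m d ⟩
    m % d + m / d * d <⟨ +-monoˡ-< (m / d * d) (m%n<n m d) ⟩
    d + m / d * d     ∎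
  where open ≤-Reasoning

∸-≤-suc-∸-suc : ∀ m n → m ∸ n ≤ suc (m ∸ suc n)
∸-≤-suc-∸-suc zero    n       = ≤-trans (≤-reflexive (0∸n≡0 n)) z≤n
∸-≤-suc-∸-suc (suc m) zero    = ≤-refl
∸-≤-suc-∸-suc (suc m) (suc n) = ∸-≤-suc-∸-suc m n

sumTo : (ℕ → ℕ) → ℕ → ℕ
sumTo f zero    = 0
sumTo f (suc n) = f n + sumTo f n

sumTo-split : ∀ f m n → sumTo f (m + n) ≡ sumTo (λ k → f (m + k)) n + sumTo f m
sumTo-split f m zero    = cong (sumTo f) (+-identityʳ m)
sumTo-split f m (suc n) = begin
    sumTo f (m + suc n)                               ≡⟨ cong (sumTo f) (+-suc m n) ⟩
    f (m + n) + sumTo f (m + n)                       ≡⟨ cong (f (m + n) +_) (sumTo-split f m n) ⟩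
    f (m + n) + (sumTo (λ k → f (m + k)) n + sumTo f m) ≡⟨ +-assoc (f (m + n)) _ _ ⟨
    sumTo (λ k → f (m + k)) (suc n) + sumTo f m         ∎
  where open ≡-Reasoning

sumTo-+ : ∀ f g n → sumTo (λ k → f k + g k) n ≡ sumTo f n + sumTo g n
sumTo-+ f g zero    = refl
sumTo-+ f g (suc n) = begin
    (f n + g n) + sumTo (λ k → f k + g k) n ≡⟨ cong ((f n + g n) +_) (sumTo-+ f g n) ⟩
    (f n + g n) + (sumTo f n + sumTo g n)   ≡⟨ interchange (f n) (g n) (sumTo f n) (sumTo g n) ⟩
    (f n + sumTo f n) + (g n + sumTo g n)   ∎
  where
    open ≡-Reasoning
    interchange : ∀ a b c d → (a + b) + (c + d) ≡ (a + c) + (b + d)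
    interchange = solve-∀

sumTo-pairs : ∀ f n → sumTo f (n + n) ≡ sumTo (λ k → f k + f (n + k)) n
sumTo-pairs f n = begin
    sumTo f (n + n)                        ≡⟨ sumTo-split f n n ⟩
    sumTo (λ k → f (n + k)) n + sumTo f n  ≡⟨ +-comm (sumTo (λ k → f (n + k)) n) _ ⟩
    sumTo f n + sumTo (λ k → f (n + k)) n  ≡⟨ sumTo-+ f (λ k → f (n + k)) n ⟨
    sumTo (λ k → f k + f (n + k)) n        ∎
  where open ≡-Reasoning

sumTo-pairs-odd : ∀ f n → sumTo f (suc n + n) ≡ f n + sumTo (λ k → f k + f (suc n + k)) n
sumTo-pairs-odd f n = begin
    sumTo f (suc n + n)                                ≡⟨ sumTo-split f (suc n) n ⟩
    sumTo (λ k → f (suc n + k)) n + (f n + sumTo f n)  ≡⟨ rotate (sumTo (λ k → f (suc n + k)) n) (f n) (sumTo f n) ⟩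
    f n + (sumTo f n + sumTo (λ k → f (suc n + k)) n)  ≡⟨ cong (f n +_) (sumTo-+ f (λ k → f (suc n + k)) n) ⟨
    f n + sumTo (λ k → f k + f (suc n + k)) n          ∎
  where
    open ≡-Reasoning
    rotate : ∀ a b c → a + (b + c) ≡ b + (c + a)
    rotate = solve-∀

sumTo-bound : ∀ f n d K → (∀ k → k < n → f k * d ≤ K) → sumTo f n * d ≤ n * K
sumTo-bound f zero    d K bound = z≤n
sumTo-bound f (suc n) d K bound = begin
    (f n + sumTo f n) * d     ≡⟨ *-distribʳ-+ d (f n) (sumTo f n) ⟩
    f n * d + sumTo f n * d   ≤⟨ +-mono-≤ (bound n ≤-refl) (sumTo-bound f n d K (λ k k<n → bound k (m≤n⇒m≤1+n k<n))) ⟩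
    K + n * K                 ∎
  where open ≤-Reasoning

-- Integer balls { a : |a| ≤ h } and annuli { a : q < |a| ≤ n } as lists

length-map-downFrom : ∀ {A : Set} (f : ℕ → A) n → length (map f (downFrom n)) ≡ n
length-map-downFrom f n = trans (length-map f (downFrom n)) (length-downFrom n)

ball : ℕ → List ℤ
ball h = map pos (downFrom (suc h)) ++ map -[1+_] (downFrom h)

length-ball : ∀ h → length (ball h) ≡ suc (h + h)
length-ball h = trans (length-++ (map pos (downFrom (suc h))))
                      (cong₂ _+_ (length-map-downFrom pos (suc h)) (length-map-downFrom -[1+_] h))

∈-ball : ∀ {a h} → ∣ a ∣ ≤ h → a ∈ ball h
∈-ball {pos m}    m≤h = ∈-++⁺ˡ (∈-map⁺ pos (∈-downFrom⁺ (s≤s m≤h)))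
∈-ball { -[1+ m ] } m<h = ∈-++⁺ʳ _ (∈-map⁺ -[1+_] (∈-downFrom⁺ m<h))

length-ball-div : ∀ x d .{{_ : NonZero d}} → length (ball (x / d)) * d ≤ 2 * x + d
length-ball-div x d = begin
    length (ball h) * d  ≡⟨ cong (_* d) (length-ball h) ⟩
    suc (h + h) * d      ≡⟨ expand h d ⟩
    2 * (h * d) + d      ≤⟨ +-monoˡ-≤ d (*-monoʳ-≤ 2 (m/n*n≤m x d)) ⟩
    2 * x + d            ∎
  where
    open ≤-Reasoning
    h : ℕ
    h = x / d
    expand : ∀ h d → suc (h + h) * d ≡ 2 * (h * d) + d
    expand = solve-∀

annulus : ℕ → ℕ → List ℤ
annulus q n = map (λ i → pos (suc (q + i))) (downFrom (n ∸ q)) ++ map (λ i → -[1+ q + i ]) (downFrom (n ∸ q))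

length-annulus : ∀ q n → length (annulus q n) ≡ 2 * (n ∸ q)
length-annulus q n = trans (length-++ (map (λ i → pos (suc (q + i))) (downFrom (n ∸ q))))
    (trans (cong₂ _+_ (length-map-downFrom (λ i → pos (suc (q + i))) (n ∸ q))
                      (length-map-downFrom (λ i → -[1+ q + i ]) (n ∸ q)))
           (cong ((n ∸ q) +_) (sym (+-identityʳ (n ∸ q)))))

∈-annulus : ∀ {a q n} → q < ∣ a ∣ → ∣ a ∣ ≤ n → a ∈ annulus q n
∈-annulus {pos (suc m)} {q} {n} (s≤s q≤m) m<n =
  subst (_∈ annulus q n) (cong (λ x → pos (suc x)) (m+[n∸m]≡n q≤m))
        (∈-++⁺ˡ (∈-map⁺ (λ i → pos (suc (q + i))) (∈-downFrom⁺ (∸-monoˡ-< m<n q≤m))))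
∈-annulus { -[1+ m ] } {q} {n} (s≤s q≤m) m<n =
  subst (_∈ annulus q n) (cong -[1+_] (m+[n∸m]≡n q≤m))
        (∈-++⁺ʳ _ (∈-map⁺ (λ i → -[1+ q + i ]) (∈-downFrom⁺ (∸-monoˡ-< m<n q≤m))))

-- Candidate lists: all (a , b) with b in a ball and a in the row r |b|.
-- Their length is a sum of row lengths, rows b ≥ 0 and b < 0 separately.

rows : {A : Set} → (ℕ → List A) → ℕ → List (A × ℤ)
rows r h = concatMap (λ b → map (λ a → (a , b)) (r ∣ b ∣)) (ball h)

length-rows : ∀ {A : Set} (r : ℕ → List A) h →
  length (rows r h) ≡ sumTo (λ k → length (r k)) (suc h) + sumTo (λ k → length (r (suc k))) h
length-rows {A} r h = begin
    length (rows r h)                                   ≡⟨ cong length (concatMap-++ row-of (map pos (downFrom (suc h))) _) ⟩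
    length (along pos (suc h) ++ along -[1+_] h)        ≡⟨ length-++ (along pos (suc h)) ⟩
    length (along pos (suc h)) + length (along -[1+_] h) ≡⟨ cong₂ _+_ (length-along pos (suc h)) (length-along -[1+_] h) ⟩
    sumTo (λ k → length (r k)) (suc h) + sumTo (λ k → length (r (suc k))) h ∎
  where
    open ≡-Reasoning
    row-of : ℤ → List (A × ℤ)
    row-of b = map (λ a → (a , b)) (r ∣ b ∣)
    along : (ℕ → ℤ) → ℕ → List (A × ℤ)
    along f n = concatMap row-of (map f (downFrom n))
    length-along : ∀ f n → length (along f n) ≡ sumTo (λ k → length (r ∣ f k ∣)) n
    length-along f zero    = refl
    length-along f (suc n) = trans (length-++ (row-of (f n)))
      (cong₂ _+_ (length-map (λ a → (a , f n)) (r ∣ f n ∣)) (length-along f n))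

-- The count, for an arbitrary bound L in place of 2l - 1

module RowCount (l₁ l₂ L : ℕ) .{{_ : NonZero l₁}} .{{_ : NonZero l₂}} where

  Region : ℤ × ℤ → Set
  Region (a , b) =
    (∣ b ∣ ≤ ∣ a ∣ → (∣ b ∣ * l₂ ≤ L) × (∣ a ∣ * l₁ ≤ L + ∣ b ∣ * l₂))
    × (∣ a ∣ ≤ ∣ b ∣ → (∣ a ∣ * l₁ ≤ L) × (∣ b ∣ * l₂ ≤ L + ∣ a ∣ * l₁))

  region? : (p : ℤ × ℤ) → Dec (Region p)
  region? (a , b) =
    ((∣ b ∣ ≤? ∣ a ∣) →-dec ((∣ b ∣ * l₂ ≤? L) ×-dec (∣ a ∣ * l₁ ≤? L + ∣ b ∣ * l₂)))
    ×-dec ((∣ a ∣ ≤? ∣ b ∣) →-dec ((∣ a ∣ * l₁ ≤? L) ×-dec (∣ b ∣ * l₂ ≤? L + ∣ a ∣ * l₁)))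

  region-inner : ∀ a b → Region (a , b) → ∣ b ∣ * l₂ ≤ L → ∣ a ∣ * l₁ ≤ L + ∣ b ∣ * l₂
  region-inner a b (case₁ , case₂) _ with ≤-total ∣ b ∣ ∣ a ∣
  ... | inj₁ b≤a = proj₂ (case₁ b≤a)
  ... | inj₂ a≤b = ≤-trans (proj₁ (case₂ a≤b)) (m≤m+n L _)

  region-outer : ∀ a b → Region (a , b) → L < ∣ b ∣ * l₂ →
                 (∣ a ∣ * l₁ ≤ L) × (∣ b ∣ * l₂ ≤ L + ∣ a ∣ * l₁)
  region-outer a b (case₁ , case₂) outer with ≤-total ∣ b ∣ ∣ a ∣
  ... | inj₁ b≤a = contradiction (proj₁ (case₁ b≤a)) (<⇒≱ outer)
  ... | inj₂ a≤b = case₂ a≤b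

  region-height : ∀ a b → Region (a , b) → ∣ b ∣ * l₂ ≤ L + L
  region-height a b p with ∣ b ∣ * l₂ ≤? L
  ... | yes inner = ≤-trans inner (m≤m+n L L)
  ... | no ¬inner = let (wa , hb) = region-outer a b p (≰⇒> ¬inner) in ≤-trans hb (+-monoʳ-≤ L wa)

  α β : ℕ
  α = L / l₁
  β = L / l₂

  reach threshold : ℕ → ℕ
  reach k     = (L + k * l₂) / l₁
  threshold k = (k * l₂ ∸ suc L) / l₁

  row : ℕ → List ℤ
  row k with k * l₂ ≤? L
  ... | yes _ = ball (reach k)
  ... | no  _ = annulus (threshold k) α

  row-inner : ∀ k → k * l₂ ≤ L → row k ≡ ball (reach k)
  row-inner k inner with k * l₂ ≤? L
  ... | yes _      = refl
  ... | no ¬inner  = contradiction inner ¬inner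

  row-outer : ∀ k → L < k * l₂ → row k ≡ annulus (threshold k) α
  row-outer k outer with k * l₂ ≤? L
  ... | yes inner = contradiction inner (<⇒≱ outer)
  ... | no _      = refl

  ∈-row : ∀ a b → Region (a , b) → a ∈ row ∣ b ∣
  ∈-row a b p with ≤-<-connex (∣ b ∣ * l₂) L
  ... | inj₁ inner = subst (a ∈_) (sym (row-inner ∣ b ∣ inner))
                      (∈-ball (≤-div ∣ a ∣ _ l₁ (region-inner a b p inner)))
  ... | inj₂ outer = subst (a ∈_) (sym (row-outer ∣ b ∣ outer))
                      (∈-annulus (m<n*o⇒m/o<n above) (≤-div ∣ a ∣ L l₁ wa))
    where
      wa : ∣ a ∣ * l₁ ≤ L
      wa = proj₁ (region-outer a b p outer)
      above : ∣ b ∣ * l₂ ∸ suc L < ∣ a ∣ * l₁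
      above = <-≤-trans (∸-monoʳ-< ≤-refl outer)
                        (m≤n+o⇒m∸n≤o _ L (proj₂ (region-outer a b p outer)))

  -- Sizes of rows, scaled by l₁.  An annulus row loses one candidate per
  -- unit of l₁ by which k l₂ exceeds L.
  width-inner : ∀ k → k * l₂ ≤ L → length (row k) * l₁ ≤ 2 * (L + k * l₂) + l₁
  width-inner k inner = subst (λ r → length r * l₁ ≤ 2 * (L + k * l₂) + l₁)
                                (sym (row-inner k inner)) (length-ball-div (L + k * l₂) l₁)

  annulus-width : ∀ k → (α ∸ threshold k) * l₁ ≤ (l₁ + L) ∸ (k * l₂ ∸ L)
  annulus-width k = begin
    (α ∸ threshold k) * l₁                  ≡⟨ *-distribʳ-∸ l₁ (suc α) (suc (threshold k)) ⟩
    suc α * l₁ ∸ suc (threshold k) * l₁     ≤⟨ ∸-mono (+-monoʳ-≤ l₁ (m/n*n≤m L l₁)) overshoot ⟩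
    (l₁ + L) ∸ (k * l₂ ∸ L)                 ∎
    where
      open ≤-Reasoning
      overshoot : k * l₂ ∸ L ≤ suc (threshold k) * l₁
      overshoot = ≤-trans (∸-≤-suc-∸-suc (k * l₂) L) (<-div-suc (k * l₂ ∸ suc L) l₁)

  width-outer : ∀ k → L < k * l₂ → length (row k) * l₁ ≤ 2 * ((l₁ + L) ∸ (k * l₂ ∸ L))
  width-outer k outer = subst (λ r → length r * l₁ ≤ 2 * ((l₁ + L) ∸ (k * l₂ ∸ L)))
                                (sym (row-outer k outer)) annulus-bound
    where
      open ≤-Reasoning
      annulus-bound : length (annulus (threshold k) α) * l₁ ≤ 2 * ((l₁ + L) ∸ (k * l₂ ∸ L))
      annulus-bound = begin
        length (annulus (threshold k) α) * l₁  ≡⟨ cong (_* l₁) (length-annulus (threshold k) α) ⟩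
        2 * (α ∸ threshold k) * l₁             ≡⟨ *-assoc 2 (α ∸ threshold k) l₁ ⟩
        2 * ((α ∸ threshold k) * l₁)           ≤⟨ *-monoʳ-≤ 2 (annulus-width k) ⟩
        2 * ((l₁ + L) ∸ (k * l₂ ∸ L))          ∎

  pair-width : ∀ k j → k * l₂ ≤ L → L + k * l₂ < j * l₂ →
               (length (row k) + length (row j)) * l₁ ≤ 4 * L + 3 * l₁
  pair-width k j inner gap = begin
      (length (row k) + length (row j)) * l₁   ≡⟨ *-distribʳ-+ l₁ (length (row k)) _ ⟩
      length (row k) * l₁ + length (row j) * l₁
        ≤⟨ +-mono-≤ (width-inner k inner) (width-outer j (≤-trans (s≤s (m≤m+n L y)) gap)) ⟩
      (2 * (L + y) + l₁) + 2 * ((l₁ + L) ∸ (j * l₂ ∸ L))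
        ≤⟨ +-monoʳ-≤ (2 * (L + y) + l₁) (*-monoʳ-≤ 2 (∸-monoʳ-≤ (l₁ + L) y≤jl₂∸L)) ⟩
      (2 * (L + y) + l₁) + 2 * ((l₁ + L) ∸ y)  ≡⟨ regroup L y ((l₁ + L) ∸ y) l₁ ⟩
      2 * (L + (y + ((l₁ + L) ∸ y))) + l₁      ≡⟨ cong (λ t → 2 * (L + t) + l₁) (m+[n∸m]≡n y≤l₁+L) ⟩
      2 * (L + (l₁ + L)) + l₁                  ≡⟨ collect L l₁ ⟩
      4 * L + 3 * l₁                           ∎
    where
      open ≤-Reasoning
      y : ℕ
      y = k * l₂
      y≤jl₂∸L : y ≤ j * l₂ ∸ L
      y≤jl₂∸L = m+n≤o⇒m≤o∸n y (≤-trans (≤-reflexive (+-comm y L)) (<⇒≤ gap))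
      y≤l₁+L : y ≤ l₁ + L
      y≤l₁+L = ≤-trans inner (m≤n+m L l₁)
      regroup : ∀ L y r a → (2 * (L + y) + a) + 2 * r ≡ 2 * (L + (y + r)) + a
      regroup = solve-∀
      collect : ∀ L a → 2 * (L + (a + L)) + a ≡ 4 * L + 3 * a
      collect = solve-∀

  c : ℕ → ℕ
  c k = length (row k)

  -- The rows k ≤ β are inner and row β + 1 + k is then far enough out.
  paired-rows : ∀ k → k ≤ β → (c k + c (suc β + k)) * l₁ ≤ 4 * L + 3 * l₁
  paired-rows k k≤β = pair-width k (suc β + k) inner gap
    where
      inner : k * l₂ ≤ L
      inner = ≤-trans (*-monoˡ-≤ l₂ k≤β) (m/n*n≤m L l₂)
      gap : L + k * l₂ < (suc β + k) * l₂
      gap = subst (L + k * l₂ <_) (sym (*-distribʳ-+ l₂ (suc β) k)) (+-monoˡ-< (k * l₂) (<-div-suc L l₂))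

  middle-row : c (suc β) * l₁ ≤ 2 * (l₁ + L)
  middle-row = ≤-trans (width-outer (suc β) (<-div-suc L l₂)) (*-monoʳ-≤ 2 (m∸n≤m (l₁ + L) (suc β * l₂ ∸ L)))

  candidates : List (ℤ × ℤ)
  candidates = rows row (β + suc β)

  -- Every point of the region is a candidate, as |b| l₂ ≤ 2L < (2β + 2) l₂.
  ∈-candidates : ∀ {p} → Region p → p ∈ candidates
  ∈-candidates {a , b} p =
    ∈-concatMap⁺ (λ b → map (λ a → (a , b)) (row ∣ b ∣)) (Any.map in-row (∈-ball height))
    where
      in-row : ∀ {x} → b ≡ x → (a , b) ∈ map (λ a′ → (a′ , x)) (row ∣ x ∣)
      in-row refl = ∈-map⁺ (λ a′ → (a′ , b)) (∈-row a b p)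
      height : ∣ b ∣ ≤ β + suc β
      height = ≤-pred (*-cancelʳ-< l₂ ∣ b ∣ (suc β + suc β) (begin-strict
        ∣ b ∣ * l₂                  ≤⟨ region-height a b p ⟩
        L + L                       <⟨ +-mono-< (<-div-suc L l₂) (<-div-suc L l₂) ⟩
        suc β * l₂ + suc β * l₂     ≡⟨ *-distribʳ-+ l₂ (suc β) (suc β) ⟨
        (suc β + suc β) * l₂        ∎))
        where open ≤-Reasoning

  -- Rows of b ≥ 0 pair up completely; rows of b < 0 pair up except β + 1.
  length-candidates-l₁ : length candidates * l₁
                         ≤ suc β * (4 * L + 3 * l₁) + (2 * (l₁ + L) + β * (4 * L + 3 * l₁))
  length-candidates-l₁ = begin
      length candidates * l₁
        ≡⟨ cong (_* l₁) (length-rows row (β + suc β)) ⟩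
      (sumTo c (suc β + suc β) + sumTo c′ (β + suc β)) * l₁
        ≡⟨ cong (λ t → (t + sumTo c′ (β + suc β)) * l₁) (sumTo-pairs c (suc β)) ⟩
      (sumTo (λ k → c k + c (suc β + k)) (suc β) + sumTo c′ (β + suc β)) * l₁
        ≡⟨ cong (λ t → (sumTo (λ k → c k + c (suc β + k)) (suc β) + t) * l₁) negative-rows ⟩
      (sumTo (λ k → c k + c (suc β + k)) (suc β) + (c′ β + sumTo (λ k → c′ k + c′ (suc β + k)) β)) * l₁
        ≡⟨ distribute (sumTo (λ k → c k + c (suc β + k)) (suc β)) (c′ β) _ l₁ ⟩
      sumTo (λ k → c k + c (suc β + k)) (suc β) * l₁
        + (c′ β * l₁ + sumTo (λ k → c′ k + c′ (suc β + k)) β * l₁)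
        ≤⟨ +-mono-≤ (sumTo-bound (λ k → c k + c (suc β + k)) (suc β) l₁ _ (λ k k<1+β → paired-rows k (≤-pred k<1+β)))
                    (+-mono-≤ middle-row (sumTo-bound (λ k → c′ k + c′ (suc β + k)) β l₁ _ (λ k k<β → shifted-pair k k<β))) ⟩
      suc β * (4 * L + 3 * l₁) + (2 * (l₁ + L) + β * (4 * L + 3 * l₁)) ∎
    where
      open ≤-Reasoning
      c′ : ℕ → ℕ
      c′ k = c (suc k)
      negative-rows : sumTo c′ (β + suc β) ≡ c′ β + sumTo (λ k → c′ k + c′ (suc β + k)) β
      negative-rows = trans (cong (sumTo c′) (+-suc β β)) (sumTo-pairs-odd c′ β)
      shifted-pair : ∀ k → k < β → (c′ k + c′ (suc β + k)) * l₁ ≤ 4 * L + 3 * l₁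
      shifted-pair k k<β = subst (λ j → (c′ k + c j) * l₁ ≤ 4 * L + 3 * l₁) (+-suc (suc β) k) (paired-rows (suc k) k<β)
      distribute : ∀ x y z d → (x + (y + z)) * d ≡ x * d + (y * d + z * d)
      distribute = solve-∀

  length-candidates : length candidates * (l₁ * l₂)
                      ≤ (2 * L + l₂) * (4 * L + 3 * l₁) + 2 * (l₁ + L) * l₂
  length-candidates = begin
      length candidates * (l₁ * l₂)  ≡⟨ *-assoc (length candidates) l₁ l₂ ⟨
      length candidates * l₁ * l₂    ≤⟨ *-monoˡ-≤ l₂ length-candidates-l₁ ⟩
      (suc β * K + (M + β * K)) * l₂ ≡⟨ regroup β K M l₂ ⟩
      (2 * (β * l₂) + l₂) * K + M * l₂
        ≤⟨ +-monoˡ-≤ (M * l₂) (*-monoˡ-≤ K (+-monoˡ-≤ l₂ (*-monoʳ-≤ 2 (m/n*n≤m L l₂)))) ⟩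
      (2 * L + l₂) * K + M * l₂      ∎
    where
      open ≤-Reasoning
      K M : ℕ
      K = 4 * L + 3 * l₁
      M = 2 * (l₁ + L)
      regroup : ∀ b K M d → (suc b * K + (M + b * K)) * d ≡ (2 * (b * d) + d) * K + M * d
      regroup = solve-∀

-- Specialisation to L = 2l - 1

_≟²_ : DecidableEquality (ℤ × ℤ)
_≟²_ = ≡-dec ℤ._≟_ ℤ._≟_

polynomial-bound : ∀ {L l₁ l₂ l} → L ≤ 2 * l → l₁ ≤ l → l₂ ≤ l →
  (2 * L + l₂) * (4 * L + 3 * l₁) + 2 * (l₁ + L) * l₂ ≤ 64 * (l * l)
polynomial-bound {L} {l₁} {l₂} {l} L≤ l₁≤ l₂≤ = begin
    (2 * L + l₂) * (4 * L + 3 * l₁) + 2 * (l₁ + L) * l₂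
      ≤⟨ +-mono-≤ (*-mono-≤ (+-mono-≤ (*-monoʳ-≤ 2 L≤) l₂≤) (+-mono-≤ (*-monoʳ-≤ 4 L≤) (*-monoʳ-≤ 3 l₁≤)))
                  (*-mono-≤ (*-monoʳ-≤ 2 (+-mono-≤ l₁≤ L≤)) l₂≤) ⟩
    (2 * (2 * l) + l) * (4 * (2 * l) + 3 * l) + 2 * (l + 2 * l) * l ≡⟨ evaluate l ⟩
    61 * (l * l)                                                    ≤⟨ *-monoˡ-≤ (l * l) (m≤m+n 61 3) ⟩
    64 * (l * l)                                                    ∎
  where
    open ≤-Reasoning
    evaluate : ∀ l → (2 * (2 * l) + l) * (4 * (2 * l) + 3 * l) + 2 * (l + 2 * l) * l ≡ 61 * (l * l)
    evaluate = solve-∀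

mainTheorem7 : (l₁ l₂ l : ℕ) → 1 ≤ l₁ → l₁ ≤ l₂ → l₂ ≤ l →
    Σ (List (ℤ × ℤ)) (λ xs →
      Unique xs
      × ((p : ℤ × ℤ) → (p ∈ xs) ⇔ InS l₁ l₂ l p)
      × (length xs * (l₁ * l₂) ≤ 64 * (l * l)))
mainTheorem7 l₁@(suc _) l₂@(suc _) l _ l₁≤l₂ l₂≤l =
    xs , UniqueDec.deduplicate-! _≟²_ selected , membership , size
  where
    open RowCount l₁ l₂ (twoLm1 l)
    selected xs : List (ℤ × ℤ)
    selected = filter region? candidates
    xs       = deduplicate _≟²_ selected
    membership : (p : ℤ × ℤ) → (p ∈ xs) ⇔ InS l₁ l₂ l p
    membership p = mk⇔ (λ p∈xs → proj₂ (∈-filter⁻ region? {xs = candidates} (∈-deduplicate⁻ _≟²_ selected p∈xs)))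
                       (λ p∈S → ∈-deduplicate⁺ _≟²_ (∈-filter⁺ region? (∈-candidates p∈S) p∈S))
    size : length xs * (l₁ * l₂) ≤ 64 * (l * l)
    size = begin
      length xs * (l₁ * l₂)         ≤⟨ *-monoˡ-≤ (l₁ * l₂) (≤-trans (length-deduplicate _≟²_ selected) (length-filter region? candidates)) ⟩
      length candidates * (l₁ * l₂) ≤⟨ length-candidates ⟩
      (2 * twoLm1 l + l₂) * (4 * twoLm1 l + 3 * l₁) + 2 * (l₁ + twoLm1 l) * l₂
                                    ≤⟨ polynomial-bound (m∸n≤m (2 * l) 1) (≤-trans l₁≤l₂ l₂≤l) l₂≤l ⟩
      64 * (l * l)                  ∎
      where open ≤-Reasoning
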